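{- Let $P$ be the infinite matrix indexed by the non-negative integers with $P(r+1,r)=1$, $P(r,r)=r-1$, $P(r,r+1)=-r-1$ for $r\geq0$, and $P(r,s)=0$ for $|r-s|>1$, and for $n\geq1$ let $P_n$ be its top-left $n\times n$ submatrix $(P(r,s))_{0\le r,s\le n-1}$. Then for each $n\geq 1$ and $i\geq 1$, \[(P_n)^i(r,s)=P^i(r,s)\quad\text{for } 0\leq r,s\leq n-1 \text{ with } r+s+i\leq 2n-1.\] -}

module Defs where

open import Data.Nat as ℕ using (ℕ; zero; suc)
open import Data.Integer using (ℤ; +_; -_; _+_; _*_; _-_; 0ℤ; 1ℤ)
open import Data.Fin using (Fin; toℕ)
import Data.Fin
open import Data.Bool using (if_then_else_)
open import Relation.Nullary.Decidable using (⌊_⌋)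

P : ℕ → ℕ → ℤ
P (suc r) s = if ⌊ r ℕ.≟ s ⌋ then 1ℤ
              else if ⌊ suc r ℕ.≟ s ⌋ then (+ suc r) - 1ℤ
              else if ⌊ suc (suc r) ℕ.≟ s ⌋ then - (+ suc r) - 1ℤ
              else 0ℤ
P zero s = if ⌊ zero ℕ.≟ s ⌋ then - 1ℤ
           else if ⌊ 1 ℕ.≟ s ⌋ then - 1ℤ
           else 0ℤ

Σ< : ℕ → (ℕ → ℤ) → ℤ
Σ< zero f = 0ℤ
Σ< (suc m) f = Σ< m f + f m

ΣFin : (n : ℕ) → (Fin n → ℤ) → ℤ
ΣFin zero f = 0ℤ
ΣFin (suc n) f = f Data.Fin.zero + ΣFin n (λ k → f (Data.Fin.suc k))


δ : ℕ → ℕ → ℤ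
δ r s = if ⌊ r ℕ.≟ s ⌋ then 1ℤ else 0ℤ

-- Powers of the infinite matrix P.  P^(i+1) = P · P^i; row r of P is
-- supported in columns k ≤ r+1, so the (a priori infinite) sum
-- Σ_k P(r,k) P^i(k,s) is exactly the finite sum over k < r+2.
Ppow : ℕ → ℕ → ℕ → ℤ
Ppow zero r s = δ r s
Ppow (suc i) r s = Σ< (suc (suc r)) (λ k → P r k * Ppow i k s)

Pn : (n : ℕ) → Fin n → Fin n → ℤ
Pn n r s = P (toℕ r) (toℕ s)

matPow : (n : ℕ) → (Fin n → Fin n → ℤ) → ℕ → Fin n → Fin n → ℤ
matPow n M zero r s = δ (toℕ r) (toℕ s)
matPow n M (suc i) r s = ΣFin n (λ k → M r k * matPow n M i k s)

-- P is tridiagonal, so row r of P meets only columns r - 1, r, r + 1, and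
-- since P has a single subdiagonal, P^i(k, s) vanishes once k > s + i.  In
-- (P_n)^(i+1)(r, s) = Σ_{k<n} P(r, k) (P_n)^i(k, s) every column k that
-- matters has k ≤ r + 1, where induction on i applies; the only term of the
-- infinite product lost by truncating is k = n (when r = n - 1), and there
-- P^i(n, s) = 0 because r + s + i + 1 ≤ 2n - 1 forces s + i < n.
module Submission where

open import Defs
open import Data.Nat using (ℕ; _≤_; _+_; _*_; _∸_)
open import Data.Fin using (Fin; toℕ)
open import Relation.Binary.PropositionalEquality using (_≡_)

open import Data.Nat using (zero; suc; _<_; _≤?_; _≟_; z≤n)
open import Data.Nat.Properties
  using (≤-trans; ≤-total; ≰⇒>; ≤-pred; <⇒≱; <⇒≢; <-irrefl; n≤1+n;
         m≤n⇒m<n∨m≡n; m≤pred[n]⇒suc[m]≤n; +-suc; +-monoˡ-≤; +-cancelˡ-<;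
         module ≤-Reasoning)
import Data.Nat.Properties as ℕ
open import Data.Integer using (ℤ; 0ℤ) renaming (_+_ to _+ℤ_; _*_ to _*ℤ_)
import Data.Integer.Properties as ℤ
import Data.Fin as Fin
open import Data.Sum using (inj₁; inj₂)
open import Data.Empty using (⊥-elim)
open import Relation.Nullary using (yes; no)
open import Relation.Binary.PropositionalEquality using (refl; sym; trans; cong; cong₂; subst; module ≡-Reasoning)

P-tridiagonalʳ : ∀ {r k} → 2 + r ≤ k → P r k ≡ 0ℤ
P-tridiagonalʳ {zero} {k} r+2≤k with zero ≟ k | 1 ≟ k
... | yes refl | _        = ⊥-elim (<⇒≱ r+2≤k z≤n)
... | no _     | yes refl = ⊥-elim (<-irrefl refl r+2≤k)
... | no _     | no _     = refl
P-tridiagonalʳ {suc r} {k} r+2≤k with r ≟ k | suc r ≟ k | suc (suc r) ≟ k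
... | yes refl | _        | _        = ⊥-elim (<⇒≱ r+2≤k (≤-trans (n≤1+n _) (n≤1+n _)))
... | no _     | yes refl | _        = ⊥-elim (<⇒≱ r+2≤k (n≤1+n _))
... | no _     | no _     | yes refl = ⊥-elim (<⇒≢ r+2≤k refl)
... | no _     | no _     | no _     = refl

P-tridiagonalˡ : ∀ {r k} → 2 + k ≤ r → P r k ≡ 0ℤ
P-tridiagonalˡ {suc r} {k} k+2≤r with r ≟ k | suc r ≟ k | suc (suc r) ≟ k
... | yes refl | _        | _        = ⊥-elim (<⇒≢ k+2≤r refl)
... | no _     | yes refl | _        = ⊥-elim (<⇒≱ k+2≤r (n≤1+n _))
... | no _     | no _     | yes refl = ⊥-elim (<⇒≱ k+2≤r (≤-trans (n≤1+n _) (n≤1+n _)))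
... | no _     | no _     | no _     = refl

≡0⇒*-irrelevantʳ : ∀ {a} x y → a ≡ 0ℤ → a *ℤ x ≡ a *ℤ y
≡0⇒*-irrelevantʳ x y refl = refl

Σ<-suc : ∀ m (f : ℕ → ℤ) → Σ< (suc m) f ≡ f 0 +ℤ Σ< m (λ k → f (suc k))
Σ<-suc zero    f = trans (ℤ.+-identityˡ (f 0)) (sym (ℤ.+-identityʳ (f 0)))
Σ<-suc (suc m) f = trans (cong (_+ℤ f (suc m)) (Σ<-suc m f)) (ℤ.+-assoc (f 0) _ _)

ΣFin≡Σ< : ∀ n {f : Fin n → ℤ} {g : ℕ → ℤ} → (∀ k → f k ≡ g (toℕ k)) → ΣFin n f ≡ Σ< n g
ΣFin≡Σ< zero    f≗g = refl
ΣFin≡Σ< (suc n) {g = g} f≗g =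
  trans (cong₂ _+ℤ_ (f≗g Fin.zero) (ΣFin≡Σ< n (λ k → f≗g (Fin.suc k)))) (sym (Σ<-suc n g))

Σ<-extend : ∀ {m m'} (f : ℕ → ℤ) → m ≤ m' → (∀ j → m ≤ j → f j ≡ 0ℤ) → Σ< m' f ≡ Σ< m f
Σ<-extend {m' = zero}  f z≤n   _ = refl
Σ<-extend {m} {suc m'} f m≤m' f≡0 with m≤n⇒m<n∨m≡n m≤m'
... | inj₂ refl = refl
... | inj₁ m<m' = begin
  Σ< m' f +ℤ f m'  ≡⟨ cong (Σ< m' f +ℤ_) (f≡0 m' (≤-pred m<m')) ⟩
  Σ< m' f +ℤ 0ℤ    ≡⟨ ℤ.+-identityʳ _ ⟩
  Σ< m' f          ≡⟨ Σ<-extend f (≤-pred m<m') f≡0 ⟩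
  Σ< m f           ∎
  where open ≡-Reasoning

Σ<-eventually-zero : ∀ {m m'} (f : ℕ → ℤ) →
  (∀ j → m ≤ j → f j ≡ 0ℤ) → (∀ j → m' ≤ j → f j ≡ 0ℤ) → Σ< m f ≡ Σ< m' f
Σ<-eventually-zero {m} {m'} f f≡0 f≡0' with ≤-total m m'
... | inj₁ m≤m' = sym (Σ<-extend f m≤m' f≡0)
... | inj₂ m'≤m = Σ<-extend f m'≤m f≡0'

Ppow≡0-below-band : ∀ i {k s} → s + i < k → Ppow i k s ≡ 0ℤ
Ppow≡0-below-band zero {k} {s} s+0<k with k ≟ s
... | yes refl = ⊥-elim (ℕ.m+n≮m s 0 s+0<k)
... | no _     = refl
Ppow≡0-below-band (suc i) {k} {s} s+1+i<k = Σ<-extend {m' = 2 + k} _ z≤n (λ j _ → term j)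
  where
  term : ∀ j → P k j *ℤ Ppow i j s ≡ 0ℤ
  term j with 2 + j ≤? k
  ... | yes j+2≤k = cong (_*ℤ Ppow i j s) (P-tridiagonalˡ j+2≤k)
  ... | no  j+2≰k = trans (cong (P k j *ℤ_) (Ppow≡0-below-band i s+i<j)) (ℤ.*-zeroʳ (P k j))
    where
    open ≤-Reasoning
    s+i<j : s + i < j
    s+i<j = ≤-pred (begin-strict
      suc (s + i)  ≡⟨ +-suc s i ⟨
      s + suc i    <⟨ s+1+i<k ⟩
      k            ≤⟨ ≤-pred (≰⇒> j+2≰k) ⟩
      suc j        ∎)

matPow-Pn≡Ppow : ∀ n i (r s : Fin n) → toℕ r + toℕ s + i < n + n →
  matPow n (Pn n) i r s ≡ Ppow i (toℕ r) (toℕ s)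
matPow-Pn≡Ppow n zero    r s _ = refl
matPow-Pn≡Ppow n (suc i) r s bound =
  trans (ΣFin≡Σ< n termwise) (Σ<-eventually-zero g g≡0-beyond-n g≡0-beyond-r+2)
  where
  r′ = toℕ r
  s′ = toℕ s
  g : ℕ → ℤ
  g k = P r′ k *ℤ Ppow i k s′

  bound′ : suc r′ + (s′ + i) < n + n
  bound′ = subst (_< n + n) (trans (+-suc (r′ + s′) i) (cong suc (ℕ.+-assoc r′ s′ i))) bound

  termwise : ∀ k → P r′ (toℕ k) *ℤ matPow n (Pn n) i k s ≡ g (toℕ k)
  termwise k with 2 + r′ ≤? toℕ k
  ... | yes r+2≤k = ≡0⇒*-irrelevantʳ _ _ (P-tridiagonalʳ r+2≤k)
  ... | no  r+2≰k = cong (P r′ (toℕ k) *ℤ_) (matPow-Pn≡Ppow n i k s k+s+i<n+n)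
    where
    open ≤-Reasoning
    k+s+i<n+n : toℕ k + s′ + i < n + n
    k+s+i<n+n = begin-strict
      toℕ k + s′ + i    ≤⟨ +-monoˡ-≤ i (+-monoˡ-≤ s′ (≤-pred (≰⇒> r+2≰k))) ⟩
      suc r′ + s′ + i   ≡⟨ ℕ.+-assoc (suc r′) s′ i ⟩
      suc r′ + (s′ + i) <⟨ bound′ ⟩
      n + n             ∎

  g≡0-beyond-r+2 : ∀ j → 2 + r′ ≤ j → g j ≡ 0ℤ
  g≡0-beyond-r+2 j r+2≤j = cong (_*ℤ Ppow i j s′) (P-tridiagonalʳ r+2≤j)

  g≡0-beyond-n : ∀ j → n ≤ j → g j ≡ 0ℤ
  g≡0-beyond-n j n≤j with 2 + r′ ≤? j
  ... | yes r+2≤j = g≡0-beyond-r+2 j r+2≤j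
  ... | no  r+2≰j = trans (cong (P r′ j *ℤ_) (Ppow≡0-below-band i s+i<j)) (ℤ.*-zeroʳ (P r′ j))
    where
    open ≤-Reasoning
    s+i<j : s′ + i < j
    s+i<j = ≤-trans (+-cancelˡ-< n (s′ + i) n (begin-strict
      n + (s′ + i)      ≤⟨ +-monoˡ-≤ (s′ + i) (≤-trans n≤j (≤-pred (≰⇒> r+2≰j))) ⟩
      suc r′ + (s′ + i) <⟨ bound′ ⟩
      n + n             ∎)) n≤j

lemma5p4 : (n i : ℕ) → 1 ≤ n → 1 ≤ i → (r s : Fin n) →
    toℕ r + toℕ s + i ≤ 2 * n ∸ 1 →
    matPow n (Pn n) i r s ≡ Ppow i (toℕ r) (toℕ s)
-- The identity also holds for i = 0.
lemma5p4 n@(suc _) i _ _ r s bound =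
  matPow-Pn≡Ppow n i r s
    (subst (toℕ r + toℕ s + i <_) (cong (n +_) (ℕ.+-identityʳ n)) (m≤pred[n]⇒suc[m]≤n bound))
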